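{- Let $P$ be a 2-program with $n$ atoms. Then $P$ has at most $g_n$ stable models, where $g_n=3^{n/3}$ if $n\equiv 0 \pmod 3$; $g_n=4\cdot 3^{(n-4)/3}$ if $n\equiv 1\pmod 3$ and $n>1$; $g_n=2\cdot 3^{(n-2)/3}$ if $n\equiv 2\pmod 3$; and $g_1=1$.
   Context: A clause is $p\leftarrow B$ or $\leftarrow B$ (a constraint), where $p$ is an atom and $B$ is a finite set of literals (atoms $a$ or negated atoms $\mathrm{not}(a)$). A propositional logic program is a finite set of clauses; it is a 2-program if every clause has at most 2 literals, counting the head. $M\subseteq\mathit{At}(P)$ (the set of atoms of $P$) is a stable model of $P$ if $M$ satisfies all constraints of $P$ and is the least model of the Gelfond–Lifschitz reduct $P^M$, obtained by deleting every non-constraint clause with some $\mathrm{not}(a)$, $a\in M$, in its body and deleting negated literals from the remaining non-constraint clauses. -}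

module Defs where

open import Data.Nat using (ℕ; zero; suc; _+_; _*_; _∸_; _^_; _≤_)
open import Data.Nat.DivMod using (_/_; _%_)
open import Data.Fin using (Fin)
open import Data.Fin.Subset using (Subset; _∈_; _∉_; _⊆_)
open import Data.Fin.Subset.Properties using (_∈?_)
open import Data.Maybe using (Maybe; just; nothing)
open import Data.List using (List; []; _∷_; length; map)
open import Data.List.Relation.Unary.All using (All)
open import Data.List.Relation.Unary.Any using (Any; any?)
open import Data.Product using (_×_; _,_)
open import Data.Sum using (_⊎_)
open import Relation.Nullary using (¬_; yes; no)
open import Relation.Binary.PropositionalEquality using (_≡_)
import Data.List.Membership.Propositional as Mem

data Literal (n : ℕ) : Set where
  pos : Fin n → Literal n
  neg : Fin n → Literal n

-- A clause  p ← B  (head = just p)  or a constraint  ← B  (head = nothing).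
-- The body (a finite set of literals) is represented by a list.
record Clause (n : ℕ) : Set where
  constructor _⟵_
  field
    head : Maybe (Fin n)
    body : List (Literal n)
open Clause public

Program : ℕ → Set
Program n = List (Clause n)

headSize : ∀ {n} → Maybe (Fin n) → ℕ
headSize (just _) = 1
headSize nothing  = 0

Is2Program : ∀ {n} → Program n → Set
Is2Program P = All (λ c → headSize (head c) + length (body c) ≤ 2) P

litAtom : ∀ {n} → Literal n → Fin n
litAtom (pos a) = a
litAtom (neg a) = a

OccursIn : ∀ {n} → Fin n → Clause n → Set
OccursIn a c = head c ≡ just a ⊎ Mem._∈_ a (map litAtom (body c))

-- At(P) = Fin n, i.e. every one of the n atoms occurs in P
AllAtomsOccur : ∀ {n} → Program n → Set
AllAtomsOccur {n} P = (a : Fin n) → Any (OccursIn a) P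

posAtoms : ∀ {n} → List (Literal n) → List (Fin n)
posAtoms []            = []
posAtoms (pos a ∷ ls)  = a ∷ posAtoms ls
posAtoms (neg _ ∷ ls)  = posAtoms ls

negAtoms : ∀ {n} → List (Literal n) → List (Fin n)
negAtoms []            = []
negAtoms (pos _ ∷ ls)  = negAtoms ls
negAtoms (neg a ∷ ls)  = a ∷ negAtoms ls

DefClause : ℕ → Set
DefClause n = Fin n × List (Fin n)

reduct : ∀ {n} → Program n → Subset n → List (DefClause n)
reduct [] M = []
reduct ((nothing ⟵ B) ∷ P) M = reduct P M
reduct ((just p ⟵ B) ∷ P) M with any? (λ a → a ∈? M) (negAtoms B)
... | yes _ = reduct P M
... | no  _ = (p , posAtoms B) ∷ reduct P M

IsModel : ∀ {n} → List (DefClause n) → Subset n → Set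
IsModel R N = All (λ c → All (λ a → a ∈ N) (Data.Product.proj₂ c) → Data.Product.proj₁ c ∈ N) R

IsLeastModel : ∀ {n} → List (DefClause n) → Subset n → Set
IsLeastModel {n} R M = IsModel R M × ((N : Subset n) → IsModel R N → M ⊆ N)

SatLit : ∀ {n} → Subset n → Literal n → Set
SatLit M (pos a) = a ∈ M
SatLit M (neg a) = a ∉ M

SatConstraints : ∀ {n} → Program n → Subset n → Set
SatConstraints P M = All (λ c → head c ≡ nothing → ¬ All (SatLit M) (body c)) P

IsStableModel : ∀ {n} → Program n → Subset n → Set
IsStableModel P M = SatConstraints P M × IsLeastModel (reduct P M) M

g : ℕ → ℕ
g 1 = 1
g n with n % 3
... | 0 = 3 ^ (n / 3)
... | 1 = 4 * 3 ^ ((n ∸ 4) / 3)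
... | _ = 2 * 3 ^ ((n ∸ 2) / 3)

{-# OPTIONS --safe #-}
module Submission where

-- For stable models M₁, …, Mₖ of a 2-program P, join two atoms p and r when every Mᵢ
-- contains p or r, and let W be the set of atoms missing from some Mᵢ. Every complement
-- ∁ Mᵢ is a maximal independent set of this graph on W. Independence is immediate;
-- domination holds because, P being a 2-program, the atoms that lie in every Mⱼ or are
-- joined to some atom outside Mᵢ form a model of the reduct P^Mᵢ, and so contain Mᵢ.
-- Distinct models have distinct complements, so the Moon–Moser bound g ∣ W ∣ ≤ g n on
-- the number of maximal independent sets applies. Moon–Moser: take v of minimum closed
-- degree d. Every maximal independent set I contains some u ∈ N[v], and I ↦ I ∖ N[u]
-- sends those containing u injectively to maximal independent sets of W ∖ N[u], which
-- has at most ∣ W ∣ ∸ d vertices. Hence there are at most d · g (∣ W ∣ ∸ d) ≤ g ∣ W ∣.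

open import Algebra.Properties.CommutativeSemigroup using (x∙yz≈y∙xz)
open import Data.Fin.Base using (Fin)
open import Data.Fin.Properties using (_≟_) renaming (any? to ∃?)
open import Data.Fin.Subset
  using ( Subset; inside; outside; _∈_; _∉_; _⊆_; _⊂_; ∁; _∩_; _∪_; _-_; ⁅_⁆; ⊥; ∣_∣; Nonempty)
open import Data.Fin.Subset.Induction using (Acc; acc; ⊂-wellFounded)
open import Data.Fin.Subset.Properties
  using ( _∈?_; nonempty?; Empty-unique; ⊆-antisym; p∩q⊆p; ∣p∩q∣≤∣p∣; ∣p∣≤n; ∪-∩-booleanAlgebra
        ; x∈p∩q⁺; x∈p∩q⁻; x∈p∪q⁺; x∈p∪q⁻; x∈∁p⇒x∉p; x∉p⇒x∈∁p; x∉∁p⇒x∈p; x∈⁅x⁆; x∈⁅y⁆⇒x≡y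
        ; x∈p∧x≢y⇒x∈p-y; p─q⊆p; x∈p⇒p-x⊂p; x∈p⇒∣p-x∣<∣p∣)
open import Data.List.Base using (List; []; _∷_; length; map; filter; allFin)
import Data.List.Extrema.Nat as Extrema
open import Data.List.Membership.Propositional using () renaming (_∈_ to _∈ₗ_)
open import Data.List.Membership.Propositional.Properties using (∈-filter⁺; ∈-allFin)
open import Data.List.Properties using (length-map; map-id; map-cong-local; map-∘)
open import Data.List.Relation.Binary.Sublist.Propositional.Properties
  using (filter-⊆; filter⁺; length-mono-≤)
open import Data.List.Relation.Unary.All as All using (All; []; _∷_)
open import Data.List.Relation.Unary.All.Properties using (all-filter)
  renaming (filter⁺ to All-filter⁺; map⁺ to All-map⁺)
open import Data.List.Relation.Unary.Any using (Any; here; there; any?)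
open import Data.List.Relation.Unary.Unique.Propositional using (Unique; []; _∷_)
import Data.List.Relation.Unary.Unique.Propositional.Properties as Unique
open import Data.Maybe.Base using (just; nothing)
open import Data.Nat.Base
  using (ℕ; suc; _+_; _*_; _∸_; _^_; _≤_; _≤′_; ≤′-reflexive; ≤′-step; z≤n; s≤s)
open import Data.Nat.DivMod using (_/_; _%_; m/n≡1+[m∸n]/n; %-remove-+ˡ)
open import Data.Nat.Divisibility using (∣-refl)
open import Data.Nat.Properties
  using ( ≤-refl; ≤-reflexive; ≤-trans; n≤1+n; m≤m+n; m≤n*m; ≤⇒≤′; +-suc; +-mono-≤; +-monoʳ-≤
        ; *-identityˡ; *-assoc; *-distribˡ-+; *-monoˡ-≤; *-monoʳ-≤; *-commutativeSemigroup
        ; m+n∸m≡n; m+[n∸m]≡n; ∸-monoʳ-≤; module ≤-Reasoning)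
open import Data.Product using (∃-syntax; _×_; _,_; proj₁; proj₂)
open import Data.Sum using (_⊎_; inj₁; inj₂; [_,_]′)
import Data.Sum as Sum
open import Data.Vec.Base using (tabulate; []; _∷_)
open import Data.Vec.Properties using (lookup∘tabulate; lookup⇒[]=; []=⇒lookup)
open import Function using (_∘_; id)
open import Induction.WellFounded as WF using (WfRec)
open import Level using (0ℓ)
open import Relation.Binary.Core using (Rel)
open import Relation.Binary.Definitions using (Symmetric) renaming (Decidable to Decidable₂)
open import Relation.Binary.PropositionalEquality
  using (_≡_; _≢_; refl; sym; trans; cong; subst; module ≡-Reasoning)
open import Relation.Nullary using (¬_; ¬?; yes; no; does; contradiction)
open import Relation.Nullary.Decidable using (dec-true; _⊎-dec_; _×-dec_)
open import Relation.Unary using (Pred; Decidable)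
open import Relation.Unary.Properties using (∁?)
open import Defs

private
  variable
    n : ℕ
    A B : Set

private
  -- The branches of the `with n % 3` defining g, named so that the residue can be rewritten.
  g-branch : ℕ → ℕ → ℕ
  g-branch n 0             = 3 ^ (n / 3)
  g-branch n 1             = 4 * 3 ^ ((n ∸ 4) / 3)
  g-branch n (suc (suc _)) = 2 * 3 ^ ((n ∸ 2) / 3)

  g-unfold : ∀ m → g (2 + m) ≡ g-branch (2 + m) ((2 + m) % 3)
  g-unfold m with (2 + m) % 3
  ... | 0           = refl
  ... | 1           = refl
  ... | suc (suc _) = refl

  [3+m]/3≡1+m/3 : ∀ m → (3 + m) / 3 ≡ suc (m / 3)
  [3+m]/3≡1+m/3 m = m/n≡1+[m∸n]/n (m≤m+n 3 m)

  [3+m]%3≡m%3 : ∀ m → (3 + m) % 3 ≡ m % 3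
  [3+m]%3≡m%3 m = %-remove-+ˡ m ∣-refl

  x*[3*y]≡3*[x*y] : ∀ x y → x * (3 * y) ≡ 3 * (x * y)
  x*[3*y]≡3*[x*y] x = x∙yz≈y∙xz *-commutativeSemigroup x 3

  g-branch[7+m]≡3*g-branch[4+m] : ∀ m r → g-branch (7 + m) r ≡ 3 * g-branch (4 + m) r
  g-branch[7+m]≡3*g-branch[4+m] m 0 = cong (3 ^_) ([3+m]/3≡1+m/3 (4 + m))
  g-branch[7+m]≡3*g-branch[4+m] m 1 =
    trans (cong (λ e → 4 * 3 ^ e) ([3+m]/3≡1+m/3 m)) (x*[3*y]≡3*[x*y] 4 (3 ^ (m / 3)))
  g-branch[7+m]≡3*g-branch[4+m] m (suc (suc _)) =
    trans (cong (λ e → 2 * 3 ^ e) ([3+m]/3≡1+m/3 (2 + m))) (x*[3*y]≡3*[x*y] 2 (3 ^ ((2 + m) / 3)))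

g[5+m]≡3*g[2+m] : ∀ m → g (5 + m) ≡ 3 * g (2 + m)
g[5+m]≡3*g[2+m] 0             = refl
g[5+m]≡3*g[2+m] 1             = refl
g[5+m]≡3*g[2+m] (suc (suc m)) = begin
  g (7 + m)                           ≡⟨ g-unfold (5 + m) ⟩
  g-branch (7 + m) ((7 + m) % 3)      ≡⟨ cong (g-branch (7 + m)) ([3+m]%3≡m%3 (4 + m)) ⟩
  g-branch (7 + m) ((4 + m) % 3)      ≡⟨ g-branch[7+m]≡3*g-branch[4+m] m ((4 + m) % 3) ⟩
  3 * g-branch (4 + m) ((4 + m) % 3)  ≡⟨ cong (3 *_) (g-unfold (2 + m)) ⟨
  3 * g (4 + m)                       ∎
  where open ≡-Reasoning

g[m]≤g[1+m] : ∀ m → g m ≤ g (suc m)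
g[m]≤g[1+m] 0 = ≤-refl
g[m]≤g[1+m] 1 = n≤1+n 1
g[m]≤g[1+m] 2 = n≤1+n 2
g[m]≤g[1+m] 3 = n≤1+n 3
g[m]≤g[1+m] 4 = m≤m+n 4 2
g[m]≤g[1+m] (suc (suc (suc (suc (suc m))))) = begin
  g (5 + m)      ≡⟨ g[5+m]≡3*g[2+m] m ⟩
  3 * g (2 + m)  ≤⟨ *-monoʳ-≤ 3 (g[m]≤g[1+m] (suc (suc m))) ⟩
  3 * g (3 + m)  ≡⟨ g[5+m]≡3*g[2+m] (suc m) ⟨
  g (6 + m)      ∎
  where open ≤-Reasoning

g-mono-≤ : ∀ {m n} → m ≤ n → g m ≤ g n
g-mono-≤ = g-mono-≤′ ∘ ≤⇒≤′
  where
  g-mono-≤′ : ∀ {m n} → m ≤′ n → g m ≤ g n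
  g-mono-≤′ (≤′-reflexive refl)         = ≤-refl
  g-mono-≤′ {n = suc n} (≤′-step m≤′n) = ≤-trans (g-mono-≤′ m≤′n) (g[m]≤g[1+m] n)

2*g[m]≤g[2+m] : ∀ m → 2 * g m ≤ g (2 + m)
2*g[m]≤g[2+m] 0 = ≤-refl
2*g[m]≤g[2+m] 1 = n≤1+n 2
2*g[m]≤g[2+m] 2 = ≤-refl
2*g[m]≤g[2+m] 3 = ≤-refl
2*g[m]≤g[2+m] 4 = n≤1+n 8
2*g[m]≤g[2+m] (suc (suc (suc (suc (suc m))))) = begin
  2 * g (5 + m)        ≡⟨ cong (2 *_) (g[5+m]≡3*g[2+m] m) ⟩
  2 * (3 * g (2 + m))  ≡⟨ x*[3*y]≡3*[x*y] 2 (g (2 + m)) ⟩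
  3 * (2 * g (2 + m))  ≤⟨ *-monoʳ-≤ 3 (2*g[m]≤g[2+m] (suc (suc m))) ⟩
  3 * g (4 + m)        ≡⟨ g[5+m]≡3*g[2+m] (2 + m) ⟨
  g (7 + m)            ∎
  where open ≤-Reasoning

3*g[m]≤g[3+m] : ∀ m → 3 * g m ≤ g (3 + m)
3*g[m]≤g[3+m] 0             = ≤-refl
3*g[m]≤g[3+m] 1             = n≤1+n 3
3*g[m]≤g[3+m] (suc (suc m)) = ≤-reflexive (sym (g[5+m]≡3*g[2+m] m))

d*g[m]≤g[d+m] : ∀ d m → d * g m ≤ g (d + m)
d*g[m]≤g[d+m] 0 m = z≤n
d*g[m]≤g[d+m] 1 m = ≤-trans (≤-reflexive (*-identityˡ (g m))) (g[m]≤g[1+m] m)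
d*g[m]≤g[d+m] 2 m = 2*g[m]≤g[2+m] m
d*g[m]≤g[d+m] 3 m = 3*g[m]≤g[3+m] m
d*g[m]≤g[d+m] (suc (suc (suc (suc d)))) m = begin
  (4 + d) * g m        ≤⟨ *-monoˡ-≤ (g m) 4+d≤2*[2+d] ⟩
  2 * (2 + d) * g m    ≡⟨ *-assoc 2 (2 + d) (g m) ⟩
  2 * ((2 + d) * g m)  ≤⟨ *-monoʳ-≤ 2 (d*g[m]≤g[d+m] (suc (suc d)) m) ⟩
  2 * g (2 + d + m)    ≤⟨ 2*g[m]≤g[2+m] (2 + d + m) ⟩
  g (4 + d + m)        ∎
  where
  open ≤-Reasoning
  4+d≤2*[2+d] : 4 + d ≤ 2 * (2 + d)
  4+d≤2*[2+d] = ≤-trans (+-monoʳ-≤ 4 (m≤n*m d 2)) (≤-reflexive (sym (*-distribˡ-+ 2 2 d)))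

length-filter+length-filter-∁ : ∀ {P : Pred A 0ℓ} (P? : Decidable P) xs →
  length (filter P? xs) + length (filter (∁? P?) xs) ≡ length xs
length-filter+length-filter-∁ P? []       = refl
length-filter+length-filter-∁ P? (x ∷ xs) with ih ← length-filter+length-filter-∁ P? xs | P? x
... | yes _ = cong suc ih
... | no  _ = trans (+-suc _ _) (cong suc ih)

All≡∧Unique⇒length≤1 : ∀ {x : A} {xs} → All (_≡ x) xs → Unique xs → length xs ≤ 1
All≡∧Unique⇒length≤1 []                _                   = z≤n
All≡∧Unique⇒length≤1 (_ ∷ [])          _                   = ≤-refl
All≡∧Unique⇒length≤1 (refl ∷ refl ∷ _) ((y≢z ∷ _) ∷ _ ∷ _) = contradiction refl y≢z

Unique-map⁺-leftInverse : ∀ {f : A → B} {h : B → A} {xs} →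
  All (λ x → h (f x) ≡ x) xs → Unique xs → Unique (map f xs)
Unique-map⁺-leftInverse {f = f} {h} {xs} h∘f≡id xs! = Unique.map⁻ (subst Unique xs≡h*f*xs xs!)
  where
  open ≡-Reasoning
  xs≡h*f*xs : xs ≡ map h (map f xs)
  xs≡h*f*xs = begin
    xs                ≡⟨ map-id xs ⟨
    map id xs         ≡⟨ map-cong-local (All.map sym h∘f≡id) ⟩
    map (h ∘ f) xs    ≡⟨ map-∘ xs ⟩
    map h (map f xs)  ∎

subsetOf : {P : Pred (Fin n) 0ℓ} → Decidable P → Subset n
subsetOf P? = tabulate (does ∘ P?)

module _ {P : Pred (Fin n) 0ℓ} (P? : Decidable P) where

  ∈-subsetOf⁺ : ∀ {x} → P x → x ∈ subsetOf P?
  ∈-subsetOf⁺ {x} px = lookup⇒[]= x _ (trans (lookup∘tabulate _ x) (dec-true (P? x) px))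

  ∈-subsetOf⁻ : ∀ {x} → x ∈ subsetOf P? → P x
  ∈-subsetOf⁻ {x} x∈ with P? x | trans (sym (lookup∘tabulate (does ∘ P?) x)) ([]=⇒lookup x∈)
  ... | yes px | _ = px
  ... | no  _  | ()

∣p∩q∣+∣p∩∁q∣≡∣p∣ : ∀ (p q : Subset n) → ∣ p ∩ q ∣ + ∣ p ∩ ∁ q ∣ ≡ ∣ p ∣
∣p∩q∣+∣p∩∁q∣≡∣p∣ []            []            = refl
∣p∩q∣+∣p∩∁q∣≡∣p∣ (outside ∷ p) (_ ∷ q)       = ∣p∩q∣+∣p∩∁q∣≡∣p∣ p q
∣p∩q∣+∣p∩∁q∣≡∣p∣ (inside ∷ p)  (inside ∷ q)  = cong suc (∣p∩q∣+∣p∩∁q∣≡∣p∣ p q)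
∣p∩q∣+∣p∩∁q∣≡∣p∣ (inside ∷ p)  (outside ∷ q) = trans (+-suc _ _) (cong suc (∣p∩q∣+∣p∩∁q∣≡∣p∣ p q))

∣p∩∁q∣≡∣p∣∸∣p∩q∣ : ∀ (p q : Subset n) → ∣ p ∩ ∁ q ∣ ≡ ∣ p ∣ ∸ ∣ p ∩ q ∣
∣p∩∁q∣≡∣p∣∸∣p∩q∣ p q = begin
  ∣ p ∩ ∁ q ∣                          ≡⟨ m+n∸m≡n ∣ p ∩ q ∣ ∣ p ∩ ∁ q ∣ ⟨
  ∣ p ∩ q ∣ + ∣ p ∩ ∁ q ∣ ∸ ∣ p ∩ q ∣  ≡⟨ cong (_∸ ∣ p ∩ q ∣) (∣p∩q∣+∣p∩∁q∣≡∣p∣ p q) ⟩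
  ∣ p ∣ ∸ ∣ p ∩ q ∣                    ∎
  where open ≡-Reasoning

∁-injective : ∀ {p q : Subset n} → ∁ p ≡ ∁ q → p ≡ q
∁-injective {n} {p} {q} ∁p≡∁q = trans (sym (¬-involutive p)) (trans (cong ∁ ∁p≡∁q) (¬-involutive q))
  where
  open import Algebra.Lattice.Properties.BooleanAlgebra (∪-∩-booleanAlgebra n)
    using (¬-involutive)

∃-minimiser : ∀ (f : Fin n → ℕ) {W : Subset n} → Nonempty W →
  ∃[ v ] v ∈ W × (∀ {u} → u ∈ W → f v ≤ f u)
∃-minimiser {n} f {W} (w , w∈W) =
  v , Extrema.argmin-all f w∈W (all-filter (_∈? W) (allFin n)) ,
  λ {u} u∈W → All.lookup (Extrema.f[argmin]≤f[xs] w xs) (∈-filter⁺ (_∈? W) (∈-allFin u) u∈W)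
  where
  xs = filter (_∈? W) (allFin n)
  v  = Extrema.argmin f w xs

Hits : Subset n → Subset n → Set
Hits S I = ∃[ u ] u ∈ S × u ∈ I

hittingSet⇒length≤∣S∣* : ∀ {S : Subset n} → Acc _⊂_ S → ∀ {F b} → All (Hits S) F →
  (∀ {u} → u ∈ S → length (filter (u ∈?_) F) ≤ b) → length F ≤ ∣ S ∣ * b
hittingSet⇒length≤∣S∣* _ [] _ = z≤n
hittingSet⇒length≤∣S∣* {S = S} (acc rec) {F} {b} hits@((w , w∈S , _) ∷ _) bound with nonempty? S
... | no  S-empty   = contradiction (w , w∈S) S-empty
... | yes (u , u∈S) = begin
  length F                                ≡⟨ length-filter+length-filter-∁ (u ∈?_) F ⟨
  length (filter (u ∈?_) F) + length F∌u  ≤⟨ +-mono-≤ (bound u∈S) ih ⟩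
  b + ∣ S - u ∣ * b                       ≤⟨ *-monoˡ-≤ b (x∈p⇒∣p-x∣<∣p∣ u∈S) ⟩
  ∣ S ∣ * b                               ∎
  where
  open ≤-Reasoning
  F∌u = filter (∁? (u ∈?_)) F
  hits′ : All (Hits (S - u)) F∌u
  hits′ = All.zipWith
    (λ ((w , w∈S , w∈I) , u∉I) → w , x∈p∧x≢y⇒x∈p-y w∈S (λ { refl → u∉I w∈I }) , w∈I)
    (All-filter⁺ (∁? (u ∈?_)) hits , all-filter (∁? (u ∈?_)) F)
  bound′ : ∀ {w} → w ∈ S - u → length (filter (w ∈?_) F∌u) ≤ b
  bound′ {w} w∈S-u = ≤-trans
    (length-mono-≤ (filter⁺ (w ∈?_) (w ∈?_) (λ { refl → id }) (filter-⊆ (∁? (u ∈?_)) F)))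
    (bound (p─q⊆p S ⁅ u ⁆ w∈S-u))
  ih : length F∌u ≤ ∣ S - u ∣ * b
  ih = hittingSet⇒length≤∣S∣* (rec (x∈p⇒p-x⊂p u∈S)) hits′ bound′

module MaximalIndependentSets {n} {_~_ : Rel (Fin n) 0ℓ}
  (~-sym : Symmetric _~_) (_~?_ : Decidable₂ _~_) where

  record IsMaximalIndependent (W I : Subset n) : Set where
    field
      ⊆-vertices  : I ⊆ W
      independent : ∀ {x y} → x ∈ I → y ∈ I → ¬ x ~ y
      dominating  : ∀ {x} → x ∈ W → x ∉ I → ∃[ y ] y ∈ I × x ~ y

  open IsMaximalIndependent

  N[_]? : ∀ u → Decidable (λ y → y ≡ u ⊎ u ~ y)
  N[ u ]? y = (y ≟ u) ⊎-dec (u ~? y)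

  N[_] : Fin n → Subset n
  N[ u ] = subsetOf N[ u ]?

  u∈N[u] : ∀ u → u ∈ N[ u ]
  u∈N[u] u = ∈-subsetOf⁺ N[ u ]? (inj₁ refl)

  W∩N[_]-hits : ∀ {W I v} → v ∈ W → IsMaximalIndependent W I → Hits (W ∩ N[ v ]) I
  W∩N[_]-hits {W} {I} {v} v∈W mis with v ∈? I
  ... | yes v∈I = v , x∈p∩q⁺ (v∈W , u∈N[u] v) , v∈I
  ... | no  v∉I with dominating mis v∈W v∉I
  ...   | y , y∈I , v~y = y , x∈p∩q⁺ (⊆-vertices mis y∈I , ∈-subsetOf⁺ N[ v ]? (inj₂ v~y)) , y∈I

  module _ {W I u} (mis : IsMaximalIndependent W I) (u∈I : u ∈ I) where

    ∉N[u] : ∀ {x} → x ∈ I → x ≢ u → x ∉ N[ u ]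
    ∉N[u] x∈I x≢u x∈N with ∈-subsetOf⁻ N[ u ]? x∈N
    ... | inj₁ x≡u = x≢u x≡u
    ... | inj₂ u~x = independent mis u∈I x∈I u~x

    dominating-∩∁N[u] : ∀ {x} → x ∈ W → x ∉ N[ u ] → x ∉ I → ∃[ y ] y ∈ I ∩ ∁ N[ u ] × x ~ y
    dominating-∩∁N[u] x∈W x∉N x∉I with dominating mis x∈W x∉I
    ... | y , y∈I , x~y = y , x∈p∩q⁺ (y∈I , x∉p⇒x∈∁p (∉N[u] y∈I y≢u)) , x~y
      where
      y≢u : y ≢ u
      y≢u refl = x∉N (∈-subsetOf⁺ N[ u ]? (inj₂ (~-sym x~y)))

    ∩∁N[u]-isMaximalIndependent : IsMaximalIndependent (W ∩ ∁ N[ u ]) (I ∩ ∁ N[ u ])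
    ∩∁N[u]-isMaximalIndependent = record
      { ⊆-vertices  = λ x∈ → let x∈I , x∈∁N = x∈p∩q⁻ I _ x∈ in x∈p∩q⁺ (⊆-vertices mis x∈I , x∈∁N)
      ; independent = λ x∈ y∈ → independent mis (proj₁ (x∈p∩q⁻ I _ x∈)) (proj₁ (x∈p∩q⁻ I _ y∈))
      ; dominating  = λ x∈ x∉ → let x∈W , x∈∁N = x∈p∩q⁻ W _ x∈ in
          dominating-∩∁N[u] x∈W (x∈∁p⇒x∉p x∈∁N) (λ x∈I → x∉ (x∈p∩q⁺ (x∈I , x∈∁N)))
      }

    ∩∁N[u]∪⁅u⁆≡ : (I ∩ ∁ N[ u ]) ∪ ⁅ u ⁆ ≡ I
    ∩∁N[u]∪⁅u⁆≡ = ⊆-antisym ⊆I I⊆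
      where
      ⊆I : (I ∩ ∁ N[ u ]) ∪ ⁅ u ⁆ ⊆ I
      ⊆I x∈ with x∈p∪q⁻ _ _ x∈
      ... | inj₁ x∈I∩∁N = proj₁ (x∈p∩q⁻ I _ x∈I∩∁N)
      ... | inj₂ x∈⁅u⁆  = subst (_∈ I) (sym (x∈⁅y⁆⇒x≡y u x∈⁅u⁆)) u∈I
      I⊆ : I ⊆ (I ∩ ∁ N[ u ]) ∪ ⁅ u ⁆
      I⊆ {x} x∈I with x ≟ u
      ... | yes refl = x∈p∪q⁺ (inj₂ (x∈⁅x⁆ u))
      ... | no  x≢u  = x∈p∪q⁺ (inj₁ (x∈p∩q⁺ (x∈I , x∉p⇒x∈∁p (∉N[u] x∈I x≢u))))

  W∩∁N[u]⊂W : ∀ {W u} → u ∈ W → W ∩ ∁ N[ u ] ⊂ W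
  W∩∁N[u]⊂W {W} {u} u∈W = p∩q⊆p W _ , u , u∈W , λ u∈ → x∈∁p⇒x∉p (proj₂ (x∈p∩q⁻ W _ u∈)) (u∈N[u] u)

  MISBound : Subset n → Set
  MISBound W = ∀ {F} → Unique F → All (IsMaximalIndependent W) F → length F ≤ g ∣ W ∣

  containing-length≤ : ∀ {W u} → u ∈ W → WfRec _⊂_ MISBound W → ∀ {G} → Unique G →
    All (λ I → IsMaximalIndependent W I × u ∈ I) G → length G ≤ g ∣ W ∩ ∁ N[ u ] ∣
  containing-length≤ {W} {u} u∈W ih {G} G! G-mis = begin
    length G                      ≡⟨ length-map (_∩ ∁ N[ u ]) G ⟨
    length (map (_∩ ∁ N[ u ]) G)  ≤⟨ ih (W∩∁N[u]⊂W u∈W) G′! G′-mis ⟩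
    g ∣ W ∩ ∁ N[ u ] ∣            ∎
    where
    open ≤-Reasoning
    G′! = Unique-map⁺-leftInverse {h = _∪ ⁅ u ⁆}
            (All.map (λ (mis , u∈I) → ∩∁N[u]∪⁅u⁆≡ mis u∈I) G-mis) G!
    G′-mis = All-map⁺ (All.map (λ (mis , u∈I) → ∩∁N[u]-isMaximalIndependent mis u∈I) G-mis)

  moonMoser : ∀ W → MISBound W
  moonMoser = WF.All.wfRec ⊂-wellFounded 0ℓ MISBound step
    where
    step : ∀ W → WfRec _⊂_ MISBound W → MISBound W
    step W ih {F} F! F-mis with nonempty? W
    ... | no W-empty = ≤-trans (All≡∧Unique⇒length≤1 (All.map ≡⊥ F-mis) F!) (g-mono-≤ (z≤n {∣ W ∣}))
      where
      ≡⊥ : ∀ {I} → IsMaximalIndependent W I → I ≡ ⊥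
      ≡⊥ mis = Empty-unique (λ (x , x∈I) → W-empty (x , ⊆-vertices mis x∈I))
    ... | yes W-nonempty with ∃-minimiser (λ u → ∣ W ∩ N[ u ] ∣) W-nonempty
    ...   | v , v∈W , v-min = begin
      length F                     ≤⟨ hittingSet⇒length≤∣S∣* (⊂-wellFounded S) S-hits through ⟩
      ∣ S ∣ * g (∣ W ∣ ∸ ∣ S ∣)    ≤⟨ d*g[m]≤g[d+m] ∣ S ∣ _ ⟩
      g (∣ S ∣ + (∣ W ∣ ∸ ∣ S ∣))  ≡⟨ cong g (m+[n∸m]≡n (∣p∩q∣≤∣p∣ W N[ v ])) ⟩
      g ∣ W ∣                      ∎
      where
      open ≤-Reasoning
      S = W ∩ N[ v ]
      S-hits = All.map W∩N[ v∈W ]-hits F-mis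
      through : ∀ {u} → u ∈ S → length (filter (u ∈?_) F) ≤ g (∣ W ∣ ∸ ∣ S ∣)
      through {u} u∈S = ≤-trans
        (containing-length≤ u∈W ih (Unique.filter⁺ (u ∈?_) F!)
          (All.zip (All-filter⁺ (u ∈?_) F-mis , all-filter (u ∈?_) F)))
        (g-mono-≤ {∣ W ∩ ∁ N[ u ] ∣}
          (≤-trans (≤-reflexive (∣p∩∁q∣≡∣p∣∸∣p∩q∣ W N[ u ])) (∸-monoʳ-≤ ∣ W ∣ (v-min u∈W))))
        where u∈W = proj₁ (x∈p∩q⁻ W _ u∈S)

Closed : Program n → Subset n → Subset n → Set
Closed P M N = ∀ {p B} → (just p ⟵ B) ∈ₗ P → ¬ Any (_∈ M) (negAtoms B) →
  All (_∈ N) (posAtoms B) → p ∈ N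

module _ {M N : Subset n} where

  reduct-model⇒closed : ∀ P → IsModel (reduct P M) N → Closed P M N
  reduct-model⇒closed ((just p ⟵ B) ∷ P) N⊨ (here refl) unblocked body⊆N
    with any? (_∈? M) (negAtoms B)
  ... | yes blocked = contradiction blocked unblocked
  ... | no  _       = All.head N⊨ body⊆N
  reduct-model⇒closed ((nothing ⟵ B) ∷ P) N⊨ (there c∈P) = reduct-model⇒closed P N⊨ c∈P
  reduct-model⇒closed ((just q ⟵ B) ∷ P) N⊨ (there c∈P) with any? (_∈? M) (negAtoms B)
  ... | yes _ = reduct-model⇒closed P N⊨ c∈P
  ... | no  _ = reduct-model⇒closed P (All.tail N⊨) c∈P

  closed⇒reduct-model : ∀ P → Closed P M N → IsModel (reduct P M) N
  closed⇒reduct-model []                  _      = []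
  closed⇒reduct-model ((nothing ⟵ B) ∷ P) closed = closed⇒reduct-model P (closed ∘ there)
  closed⇒reduct-model ((just p ⟵ B) ∷ P)  closed with any? (_∈? M) (negAtoms B)
  ... | yes _         = closed⇒reduct-model P (closed ∘ there)
  ... | no  unblocked = closed (here refl) unblocked ∷ closed⇒reduct-model P (closed ∘ there)

stable⇒closed : ∀ {P : Program n} {M} → IsStableModel P M → Closed P M M
stable⇒closed {P = P} (_ , model , _) = reduct-model⇒closed P model

module ModelGraph {n} (Ms : List (Subset n)) where

  _~_ : Fin n → Fin n → Set
  p ~ r = All (λ M → p ∈ M ⊎ r ∈ M) Ms

  _~?_ : Decidable₂ _~_
  p ~? r = All.all? (λ M → (p ∈? M) ⊎-dec (r ∈? M)) Ms

  ~-sym : Symmetric _~_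
  ~-sym = All.map Sum.swap

  open MaximalIndependentSets ~-sym _~?_ public

  Omitted : Fin n → Set
  Omitted p = ¬ All (p ∈_) Ms

  Omitted? : Decidable Omitted
  Omitted? p = ¬? (All.all? (p ∈?_) Ms)

  omitted : Subset n
  omitted = subsetOf Omitted?

  Justified : Subset n → Fin n → Set
  Justified M p = All (p ∈_) Ms ⊎ ∃[ r ] r ∉ M × p ~ r

  Justified? : ∀ M → Decidable (Justified M)
  Justified? M p = All.all? (p ∈?_) Ms ⊎-dec ∃? (λ r → ¬? (r ∈? M) ×-dec (p ~? r))

  module _ {P : Program n} (P-2 : Is2Program P) (Ms-closed : All (λ M → Closed P M M) Ms) where

    -- The only use of the 2-program hypothesis: a clause has at most one body literal,
    -- and the head inherits its justification from that literal.
    justified-closed : ∀ M → Closed P M (subsetOf (Justified? M))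
    justified-closed M {p} {[]} c∈P _ _ =
      ∈-subsetOf⁺ (Justified? M) (inj₁ (All.map (λ closed → closed c∈P (λ ()) []) Ms-closed))
    justified-closed M {p} {pos a ∷ []} c∈P _ (a∈J ∷ []) with ∈-subsetOf⁻ (Justified? M) a∈J
    ... | inj₁ a∈Ms = ∈-subsetOf⁺ (Justified? M)
      (inj₁ (All.zipWith (λ (closed , a∈M′) → closed c∈P (λ ()) (a∈M′ ∷ [])) (Ms-closed , a∈Ms)))
    ... | inj₂ (r , r∉M , a~r) = ∈-subsetOf⁺ (Justified? M) (inj₂ (r , r∉M ,
      All.zipWith (λ (closed , a∈M′⊎r∈M′) → Sum.map₁ (λ a∈M′ → closed c∈P (λ ()) (a∈M′ ∷ []))
                                                     a∈M′⊎r∈M′)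
                  (Ms-closed , a~r)))
    justified-closed M {p} {neg r ∷ []} c∈P unblocked [] =
      ∈-subsetOf⁺ (Justified? M) (inj₂ (r , (λ r∈M → unblocked (here r∈M)) , All.map p∨r Ms-closed))
      where
      p∨r : ∀ {M′} → Closed P M′ M′ → p ∈ M′ ⊎ r ∈ M′
      p∨r {M′} closed with r ∈? M′
      ... | yes r∈M′ = inj₂ r∈M′
      ... | no  r∉M′ = inj₁ (closed c∈P (λ { (here r∈M′) → r∉M′ r∈M′ }) [])
    justified-closed M {B = _ ∷ _ ∷ _} c∈P = contradiction (All.lookup P-2 c∈P) λ { (s≤s (s≤s ())) }

  module _ {P : Program n} (P-2 : Is2Program P) (Ms-stable : All (IsStableModel P) Ms) where

    ∁-isMaximalIndependent : ∀ {M} → M ∈ₗ Ms → IsMaximalIndependent omitted (∁ M)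
    ∁-isMaximalIndependent {M} M∈Ms = record
      { ⊆-vertices  = λ x∈∁M → ∈-subsetOf⁺ Omitted? (λ x∈Ms → x∈∁p⇒x∉p x∈∁M (All.lookup x∈Ms M∈Ms))
      ; independent = λ x∈∁M y∈∁M x~y → [ x∈∁p⇒x∉p x∈∁M , x∈∁p⇒x∉p y∈∁M ]′ (All.lookup x~y M∈Ms)
      ; dominating  = dominating
      }
      where
      M⊆J : M ⊆ subsetOf (Justified? M)
      M⊆J = proj₂ (proj₂ (All.lookup Ms-stable M∈Ms)) _
              (closed⇒reduct-model P (justified-closed P-2 (All.map stable⇒closed Ms-stable) M))
      dominating : ∀ {x} → x ∈ omitted → x ∉ ∁ M → ∃[ y ] y ∈ ∁ M × x ~ y
      dominating x∈W x∉∁M with ∈-subsetOf⁻ (Justified? M) (M⊆J (x∉∁p⇒x∈p x∉∁M))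
      ... | inj₁ x∈Ms            = contradiction x∈Ms (∈-subsetOf⁻ Omitted? x∈W)
      ... | inj₂ (r , r∉M , x~r) = r , x∉p⇒x∈∁p r∉M , x~r

corollary2 : (n : ℕ) (P : Program n) → Is2Program P → AllAtomsOccur P →
    (Ms : List (Subset n)) → Unique Ms → All (IsStableModel P) Ms →
    length Ms ≤ g n
corollary2 n P P-2 _ Ms Ms! Ms-stable = begin
  length Ms          ≡⟨ length-map ∁ Ms ⟨
  length (map ∁ Ms)  ≤⟨ moonMoser omitted (Unique.map⁺ ∁-injective Ms!) ∁Ms-mis ⟩
  g ∣ omitted ∣      ≤⟨ g-mono-≤ (∣p∣≤n omitted) ⟩
  g n                ∎
  where
  open ModelGraph Ms
  open ≤-Reasoning
  ∁Ms-mis = All-map⁺ (All.tabulate (∁-isMaximalIndependent P-2 Ms-stable))
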